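{- Let $\Omega_1, \Omega_2$ be finite nonempty sets and let $T:\Omega_1\times\Omega_2\to \{0,1\}$ be (the indicator of a set which is) $(\tau,\gamma)$-combinatorially spread. Let $k,\ell\ge 1$ and let $E \subseteq [k]\times[\ell]$ be the edge set of a bipartite graph on vertex classes $[k]$ and $[\ell]$, with $(i^*,j^*)\in E$. For each $(i,j)\in E\setminus \{(i^*,j^*)\}$ let $f_{ij}: \Omega_1\times\Omega_2\to [0,1]$. Then \[ \mathop{\mathbb{E}}_{\substack{x_1,\dots,x_k \in \Omega_1 \\ y_1,\dots,y_\ell \in \Omega_2}} \Big[T(x_{i^*},y_{j^*}) \prod_{(i,j) \in E\setminus \{(i^*,j^*)\}} f_{ij}(x_{i},y_{j}) \Big] \le \tau \mathop{\mathbb{E}}_{\substack{x_1,\dots,x_k \in \Omega_1 \\ y_1,\dots,y_\ell \in \Omega_2}} \Big[\prod_{(i,j) \in E\setminus \{(i^*,j^*)\}} f_{ij}(x_{i},y_{j}) \Big] + \gamma. \]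
   Context: Expectations are with respect to uniform measures. A subset $T \subseteq \Omega_1 \times \Omega_2$ is $(\tau,\gamma)$-combinatorially spread if for all functions $f: \Omega_1 \to [0,1]$ and $g: \Omega_2 \to [0,1]$, $\mathop{\mathbb{E}}_{x \in \Omega_1, y \in \Omega_2}[f(x)g(y)\mathbbm{1}_T(x,y)] \le \tau\mathop{\mathbb{E}}_{x}[f(x)] \mathop{\mathbb{E}}_{y}[g(y)] + \gamma$.
   Formalization: The parameters τ and γ are rational and the functions $f_{ij}$ take rational values, and the test functions f and g in the definition of combinatorial spreadness are likewise taken with values in ℚ. -}

module Defs where

open import Data.Nat as ℕ using (ℕ; zero; suc; NonZero)
open import Data.Integer using (+_)
open import Data.Fin using (Fin; zero; suc; _≟_)
open import Data.Bool using (Bool; true; false; if_then_else_)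
open import Data.Vec.Functional using (_∷_)
open import Data.Rational using (ℚ; 0ℚ; 1ℚ; _+_; _*_; _≤_; _/_)
open import Data.Product using (_×_)
open import Relation.Nullary.Decidable using (⌊_⌋)
open import Data.Bool using (_∧_; not)

sumFin : (n : ℕ) → (Fin n → ℚ) → ℚ
sumFin zero    f = 0ℚ
sumFin (suc n) f = f zero + sumFin n (λ i → f (suc i))

prodFin : (n : ℕ) → (Fin n → ℚ) → ℚ
prodFin zero    f = 1ℚ
prodFin (suc n) f = f zero * prodFin n (λ i → f (suc i))

𝔼 : (m : ℕ) → .{{_ : NonZero m}} → (Fin m → ℚ) → ℚ
𝔼 m f = sumFin m f * ((+ 1) / m)

𝔼ᵏ : (k m : ℕ) → .{{_ : NonZero m}} → ((Fin k → Fin m) → ℚ) → ℚ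
𝔼ᵏ zero    m F = F (λ ())
𝔼ᵏ (suc k) m F = 𝔼 m (λ a → 𝔼ᵏ k m (λ xs → F (a ∷ xs)))

𝟙 : Bool → ℚ
𝟙 true  = 1ℚ
𝟙 false = 0ℚ

In01 : ℚ → Set
In01 q = (0ℚ ≤ q) × (q ≤ 1ℚ)

CombSpread : (m n : ℕ) → .{{_ : NonZero m}} → .{{_ : NonZero n}} →
             (Fin m → Fin n → Bool) → ℚ → ℚ → Set
CombSpread m n T τ γ =
  (f : Fin m → ℚ) (g : Fin n → ℚ) →
  (∀ x → In01 (f x)) → (∀ y → In01 (g y)) →
  𝔼 m (λ x → 𝔼 n (λ y → f x * g y * 𝟙 (T x y)))
    ≤ τ * 𝔼 m f * 𝔼 n g + γ

InEMinus : {k ℓ : ℕ} → (Fin k → Fin ℓ → Bool) → Fin k → Fin ℓ →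
           Fin k → Fin ℓ → Bool
InEMinus E i* j* i j = E i j ∧ not (⌊ i ≟ i* ⌋ ∧ ⌊ j ≟ j* ⌋)

prodEdges : {k ℓ m n : ℕ} → (Fin k → Fin ℓ → Bool) → Fin k → Fin ℓ →
            (Fin k → Fin ℓ → Fin m → Fin n → ℚ) →
            (Fin k → Fin m) → (Fin ℓ → Fin n) → ℚ
prodEdges {k} {ℓ} E i* j* f xs ys =
  prodFin k (λ i → prodFin ℓ (λ j →
    if InEMinus E i* j* i j then f i j (xs i) (ys j) else 1ℚ))

-- Resample the coordinates x_{i*} and y_{j*}: replacing them by fresh uniform
-- values a, b does not change either side. Once the other coordinates are fixed,
-- and since the factor at (i*,j*) is absent, the product of edge weights splits
-- as A(a)·B(b)·C with A, B, C in [0,1]: A collects the edges at i*, B the other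
-- edges at j*, and C the rest. Spreadness applied to A and B, with C ≤ 1 and
-- γ ≥ 0 (spreadness at f = g = 0), bounds the average over a, b by
-- τ·E[A B C] + γ, and averaging over the remaining coordinates keeps this bound.

module Submission where

open import Defs
open import Algebra.Bundles using (Ring)
open import Data.Bool using (Bool; true; false; if_then_else_; _∧_; _∨_; not)
open import Data.Bool.Properties using (∧-zeroʳ)
open import Data.Fin using (Fin; zero; suc; _≟_)
import Data.Integer as ℤ
open import Data.Nat using (ℕ; zero; suc; NonZero)
import Data.Nat.Properties as ℕ
open import Data.Product using (_,_)
open import Data.Rational using (ℚ; 0ℚ; 1ℚ; _+_; _*_; _≤_; _/_; toℚᵘ; nonNegative)
open import Data.Rational.Properties hiding (_≟_)
open import Data.Rational.Solver using (module +-*-Solver)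
open import Data.Rational.Unnormalised as ℚᵘ using (mkℚᵘ; *≡*)
import Data.Rational.Unnormalised.Properties as ℚᵘ
open import Data.Vec.Functional using (_∷_; head; tail)
open import Relation.Binary.PropositionalEquality
open import Relation.Nullary using (yes; no; contradiction)
open import Relation.Nullary.Decidable using (⌊_⌋)

open import Algebra.Properties.Semiring.Sum (Ring.semiring +-*-ring)
  using (sum; ∑-comm; ∑-distrib-+; *-distribˡ-sum)
open import Algebra.Properties.CommutativeMonoid.Sum *-1-commutativeMonoid
  using () renaming (sum to prod; ∑-distrib-+ to ∏-distrib-*)
open +-*-Solver

sumFin≡sum : ∀ n (f : Fin n → ℚ) → sumFin n f ≡ sum f
sumFin≡sum zero    f = refl
sumFin≡sum (suc n) f = cong (f zero +_) (sumFin≡sum n (λ i → f (suc i)))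

prodFin≡prod : ∀ n (f : Fin n → ℚ) → prodFin n f ≡ prod f
prodFin≡prod zero    f = refl
prodFin≡prod (suc n) f = cong (f zero *_) (prodFin≡prod n (λ i → f (suc i)))

sumFin-cong : ∀ n {f g : Fin n → ℚ} → f ≗ g → sumFin n f ≡ sumFin n g
sumFin-cong zero    f≗g = refl
sumFin-cong (suc n) f≗g = cong₂ _+_ (f≗g zero) (sumFin-cong n (λ i → f≗g (suc i)))

sumFin-mono-≤ : ∀ n {f g : Fin n → ℚ} → (∀ i → f i ≤ g i) → sumFin n f ≤ sumFin n g
sumFin-mono-≤ zero    f≤g = ≤-refl
sumFin-mono-≤ (suc n) f≤g = +-mono-≤ (f≤g zero) (sumFin-mono-≤ n (λ i → f≤g (suc i)))

sumFin-+ : ∀ n (f g : Fin n → ℚ) → sumFin n (λ i → f i + g i) ≡ sumFin n f + sumFin n g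
sumFin-+ n f g = begin
  sumFin n (λ i → f i + g i)  ≡⟨ sumFin≡sum n _ ⟩
  sum (λ i → f i + g i)       ≡⟨ ∑-distrib-+ f g ⟩
  sum f + sum g               ≡⟨ sym (cong₂ _+_ (sumFin≡sum n f) (sumFin≡sum n g)) ⟩
  sumFin n f + sumFin n g     ∎
  where open ≡-Reasoning

sumFin-*ˡ : ∀ n c (f : Fin n → ℚ) → sumFin n (λ i → c * f i) ≡ c * sumFin n f
sumFin-*ˡ n c f = begin
  sumFin n (λ i → c * f i)  ≡⟨ sumFin≡sum n _ ⟩
  sum (λ i → c * f i)       ≡⟨ sym (*-distribˡ-sum c f) ⟩
  c * sum f                 ≡⟨ cong (c *_) (sym (sumFin≡sum n f)) ⟩
  c * sumFin n f            ∎
  where open ≡-Reasoning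

sumFin-*ʳ : ∀ n c (f : Fin n → ℚ) → sumFin n (λ i → f i * c) ≡ sumFin n f * c
sumFin-*ʳ n c f = trans (sumFin-cong n (λ i → *-comm (f i) c)) (trans (sumFin-*ˡ n c f) (*-comm c _))

sumFin-comm : ∀ m n (F : Fin m → Fin n → ℚ) →
              sumFin m (λ a → sumFin n (F a)) ≡ sumFin n (λ b → sumFin m (λ a → F a b))
sumFin-comm m n F = trans (sumFin²≡sum² m n F) (trans (∑-comm F) (sym (sumFin²≡sum² n m (λ b a → F a b))))
  where
  sumFin²≡sum² : ∀ m n (F : Fin m → Fin n → ℚ) → sumFin m (λ a → sumFin n (F a)) ≡ sum (λ a → sum (F a))
  sumFin²≡sum² m n F = trans (sumFin-cong m (λ a → sumFin≡sum n (F a))) (sumFin≡sum m _)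

prodFin-cong : ∀ n {f g : Fin n → ℚ} → f ≗ g → prodFin n f ≡ prodFin n g
prodFin-cong zero    f≗g = refl
prodFin-cong (suc n) f≗g = cong₂ _*_ (f≗g zero) (prodFin-cong n (λ i → f≗g (suc i)))

prodFin-* : ∀ n (f g : Fin n → ℚ) → prodFin n (λ i → f i * g i) ≡ prodFin n f * prodFin n g
prodFin-* n f g = begin
  prodFin n (λ i → f i * g i) ≡⟨ prodFin≡prod n _ ⟩
  prod (λ i → f i * g i)      ≡⟨ ∏-distrib-* f g ⟩
  prod f * prod g             ≡⟨ sym (cong₂ _*_ (prodFin≡prod n f) (prodFin≡prod n g)) ⟩
  prodFin n f * prodFin n g   ∎
  where open ≡-Reasoning

-- Arithmetic on ℚ normalises by a gcd that does not reduce for a variable m,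
-- so the identity 𝔼 m (λ _ → 1ℚ) ≡ 1ℚ is computed in ℚᵘ.
toℚᵘ-sumFin-1 : ∀ n → toℚᵘ (sumFin n (λ _ → 1ℚ)) ℚᵘ.≃ mkℚᵘ (ℤ.+ n) 0
toℚᵘ-sumFin-1 zero    = ℚᵘ.≃-refl
toℚᵘ-sumFin-1 (suc n) = begin
  toℚᵘ (1ℚ + sumFin n (λ _ → 1ℚ))            ≈⟨ toℚᵘ-homo-+ 1ℚ (sumFin n (λ _ → 1ℚ)) ⟩
  toℚᵘ 1ℚ ℚᵘ.+ toℚᵘ (sumFin n (λ _ → 1ℚ))    ≈⟨ ℚᵘ.+-congʳ (toℚᵘ 1ℚ) (toℚᵘ-sumFin-1 n) ⟩
  toℚᵘ 1ℚ ℚᵘ.+ mkℚᵘ (ℤ.+ n) 0                ≈⟨ 1+≃suc n ⟩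
  mkℚᵘ (ℤ.+ suc n) 0                         ∎
  where
  open ℚᵘ.≃-Reasoning
  1+≃suc : ∀ k → toℚᵘ 1ℚ ℚᵘ.+ mkℚᵘ (ℤ.+ k) 0 ℚᵘ.≃ mkℚᵘ (ℤ.+ suc k) 0
  1+≃suc zero    = *≡* refl
  1+≃suc (suc k) = *≡* (cong (λ t → ℤ.+ suc (suc t) ℤ.* ℤ.+ 1) (ℕ.*-identityʳ k))

𝔼-one : ∀ m .{{_ : NonZero m}} → 𝔼 m (λ _ → 1ℚ) ≡ 1ℚ
𝔼-one (suc m) = toℚᵘ-injective (begin
  toℚᵘ (sumFin (suc m) (λ _ → 1ℚ) * (ℤ.+ 1 / suc m))            ≈⟨ toℚᵘ-homo-* (sumFin (suc m) (λ _ → 1ℚ)) _ ⟩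
  toℚᵘ (sumFin (suc m) (λ _ → 1ℚ)) ℚᵘ.* toℚᵘ (ℤ.+ 1 / suc m)   ≈⟨ ℚᵘ.*-cong (toℚᵘ-sumFin-1 (suc m)) (toℚᵘ-fromℚᵘ (mkℚᵘ (ℤ.+ 1) m)) ⟩
  mkℚᵘ (ℤ.+ suc m) 0 ℚᵘ.* mkℚᵘ (ℤ.+ 1) m                        ≈⟨ ℚᵘ.*-inverseʳ (mkℚᵘ (ℤ.+ suc m) 0) ⟩
  ℚᵘ.1ℚᵘ                                                        ∎)
  where open ℚᵘ.≃-Reasoning

𝔼-cong : ∀ m .{{_ : NonZero m}} {f g : Fin m → ℚ} → f ≗ g → 𝔼 m f ≡ 𝔼 m g
𝔼-cong m f≗g = cong (_* (ℤ.+ 1 / m)) (sumFin-cong m f≗g)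

𝔼-mono-≤ : ∀ m .{{_ : NonZero m}} {f g : Fin m → ℚ} → (∀ i → f i ≤ g i) → 𝔼 m f ≤ 𝔼 m g
𝔼-mono-≤ m f≤g = *-monoʳ-≤-nonNeg (ℤ.+ 1 / m) {{normalize-nonNeg 1 m}} (sumFin-mono-≤ m f≤g)

𝔼-*ˡ : ∀ m .{{_ : NonZero m}} c (f : Fin m → ℚ) → 𝔼 m (λ i → c * f i) ≡ c * 𝔼 m f
𝔼-*ˡ m c f = trans (cong (_* (ℤ.+ 1 / m)) (sumFin-*ˡ m c f)) (*-assoc c _ _)

𝔼-*ʳ : ∀ m .{{_ : NonZero m}} c (f : Fin m → ℚ) → 𝔼 m (λ i → f i * c) ≡ 𝔼 m f * c
𝔼-*ʳ m c f = trans (𝔼-cong m (λ i → *-comm (f i) c)) (trans (𝔼-*ˡ m c f) (*-comm c _))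

𝔼-+ : ∀ m .{{_ : NonZero m}} (f g : Fin m → ℚ) → 𝔼 m (λ i → f i + g i) ≡ 𝔼 m f + 𝔼 m g
𝔼-+ m f g = trans (cong (_* (ℤ.+ 1 / m)) (sumFin-+ m f g)) (*-distribʳ-+ (ℤ.+ 1 / m) (sumFin m f) (sumFin m g))

𝔼-const : ∀ m .{{_ : NonZero m}} c → 𝔼 m (λ _ → c) ≡ c
𝔼-const m c = begin
  𝔼 m (λ _ → c)        ≡⟨ 𝔼-cong m (λ _ → sym (*-identityʳ c)) ⟩
  𝔼 m (λ _ → c * 1ℚ)   ≡⟨ 𝔼-*ˡ m c (λ _ → 1ℚ) ⟩
  c * 𝔼 m (λ _ → 1ℚ)   ≡⟨ cong (c *_) (𝔼-one m) ⟩
  c * 1ℚ               ≡⟨ *-identityʳ c ⟩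
  c                    ∎
  where open ≡-Reasoning

𝔼-affine : ∀ m .{{_ : NonZero m}} τ γ (f : Fin m → ℚ) → 𝔼 m (λ i → τ * f i + γ) ≡ τ * 𝔼 m f + γ
𝔼-affine m τ γ f = trans (𝔼-+ m _ _) (cong₂ _+_ (𝔼-*ˡ m τ f) (𝔼-const m γ))

𝔼-comm : ∀ m n .{{_ : NonZero m}} .{{_ : NonZero n}} (F : Fin m → Fin n → ℚ) →
         𝔼 m (λ a → 𝔼 n (F a)) ≡ 𝔼 n (λ b → 𝔼 m (λ a → F a b))
𝔼-comm m n F = begin
  sumFin m (λ a → sumFin n (F a) * rₙ) * rₘ            ≡⟨ cong (_* rₘ) (sumFin-*ʳ m rₙ _) ⟩
  sumFin m (λ a → sumFin n (F a)) * rₙ * rₘ            ≡⟨ cong (λ s → s * rₙ * rₘ) (sumFin-comm m n F) ⟩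
  S * rₙ * rₘ                                          ≡⟨ solve 3 (λ s x y → s :* x :* y := s :* y :* x) refl S rₙ rₘ ⟩
  S * rₘ * rₙ                                          ≡⟨ cong (_* rₙ) (sym (sumFin-*ʳ n rₘ _)) ⟩
  sumFin n (λ b → sumFin m (λ a → F a b) * rₘ) * rₙ    ∎
  where
  open ≡-Reasoning
  rₘ = ℤ.+ 1 / m
  rₙ = ℤ.+ 1 / n
  S = sumFin n (λ b → sumFin m (λ a → F a b))

𝔼ᵏ-cong : ∀ k m .{{_ : NonZero m}} {F G : (Fin k → Fin m) → ℚ} → F ≗ G → 𝔼ᵏ k m F ≡ 𝔼ᵏ k m G
𝔼ᵏ-cong zero    m F≗G = F≗G _
𝔼ᵏ-cong (suc k) m F≗G = 𝔼-cong m (λ a → 𝔼ᵏ-cong k m (λ xs → F≗G (a ∷ xs)))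

𝔼ᵏ-mono-≤ : ∀ k m .{{_ : NonZero m}} {F G : (Fin k → Fin m) → ℚ} → (∀ xs → F xs ≤ G xs) → 𝔼ᵏ k m F ≤ 𝔼ᵏ k m G
𝔼ᵏ-mono-≤ zero    m F≤G = F≤G _
𝔼ᵏ-mono-≤ (suc k) m F≤G = 𝔼-mono-≤ m (λ a → 𝔼ᵏ-mono-≤ k m (λ xs → F≤G (a ∷ xs)))

𝔼ᵏ-affine : ∀ k m .{{_ : NonZero m}} τ γ (F : (Fin k → Fin m) → ℚ) →
            𝔼ᵏ k m (λ xs → τ * F xs + γ) ≡ τ * 𝔼ᵏ k m F + γ
𝔼ᵏ-affine zero    m τ γ F = refl
𝔼ᵏ-affine (suc k) m τ γ F =
  trans (𝔼-cong m (λ a → 𝔼ᵏ-affine k m τ γ (λ xs → F (a ∷ xs)))) (𝔼-affine m τ γ _)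

𝔼ᵏ-comm-𝔼 : ∀ k m n .{{_ : NonZero m}} .{{_ : NonZero n}} (F : (Fin k → Fin m) → Fin n → ℚ) →
            𝔼ᵏ k m (λ xs → 𝔼 n (F xs)) ≡ 𝔼 n (λ b → 𝔼ᵏ k m (λ xs → F xs b))
𝔼ᵏ-comm-𝔼 zero    m n F = refl
𝔼ᵏ-comm-𝔼 (suc k) m n F = trans (𝔼-cong m (λ a → 𝔼ᵏ-comm-𝔼 k m n (λ xs → F (a ∷ xs))))
                                 (𝔼-comm m n (λ a b → 𝔼ᵏ k m (λ xs → F (a ∷ xs) b)))

-- Unlike `updateAt`, at index zero this reduces to `a ∷ tail xs` before being
-- applied to an index; `𝔼ᵏ-resample` relies on that.
infixl 6 _[_]≔_
_[_]≔_ : ∀ {k} {A : Set} → (Fin k → A) → Fin k → A → Fin k → A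
xs [ zero  ]≔ a = a ∷ tail xs
xs [ suc i ]≔ a = head xs ∷ (tail xs [ i ]≔ a)

[]≔-updates : ∀ {k} {A : Set} (xs : Fin k → A) i a → (xs [ i ]≔ a) i ≡ a
[]≔-updates xs zero    a = refl
[]≔-updates xs (suc i) a = []≔-updates (tail xs) i a

[]≔-minimal : ∀ {k} {A : Set} (xs : Fin k → A) i a {j} → j ≢ i → (xs [ i ]≔ a) j ≡ xs j
[]≔-minimal xs zero    a {zero}  j≢i = contradiction refl j≢i
[]≔-minimal xs zero    a {suc j} j≢i = refl
[]≔-minimal xs (suc i) a {zero}  j≢i = refl
[]≔-minimal xs (suc i) a {suc j} j≢i = []≔-minimal (tail xs) i a (λ j≡i → j≢i (cong suc j≡i))

𝔼ᵏ-resample : ∀ k m .{{_ : NonZero m}} (i : Fin k) (F : (Fin k → Fin m) → ℚ) →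
              𝔼ᵏ k m F ≡ 𝔼ᵏ k m (λ xs → 𝔼 m (λ a → F (xs [ i ]≔ a)))
𝔼ᵏ-resample (suc k) m zero    F =
  sym (trans (𝔼-const m _) (𝔼ᵏ-comm-𝔼 k m m (λ xs a → F (a ∷ xs))))
𝔼ᵏ-resample (suc k) m (suc i) F = 𝔼-cong m (λ a → 𝔼ᵏ-resample k m i (λ xs → F (a ∷ xs)))

𝔼ᵏ²-resample : ∀ k ℓ m n .{{_ : NonZero m}} .{{_ : NonZero n}} (i : Fin k) (j : Fin ℓ)
               (F : (Fin k → Fin m) → (Fin ℓ → Fin n) → ℚ) →
               𝔼ᵏ k m (λ xs → 𝔼ᵏ ℓ n (F xs)) ≡
               𝔼ᵏ k m (λ xs → 𝔼ᵏ ℓ n (λ ys → 𝔼 m (λ a → 𝔼 n (λ b → F (xs [ i ]≔ a) (ys [ j ]≔ b)))))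
𝔼ᵏ²-resample k ℓ m n i j F = begin
  𝔼ᵏ k m (λ xs → 𝔼ᵏ ℓ n (F xs))
    ≡⟨ 𝔼ᵏ-cong k m (λ xs → 𝔼ᵏ-resample ℓ n j (F xs)) ⟩
  𝔼ᵏ k m (λ xs → 𝔼ᵏ ℓ n (λ ys → 𝔼 n (λ b → F xs (ys [ j ]≔ b))))
    ≡⟨ 𝔼ᵏ-resample k m i _ ⟩
  𝔼ᵏ k m (λ xs → 𝔼 m (λ a → 𝔼ᵏ ℓ n (λ ys → 𝔼 n (λ b → F (xs [ i ]≔ a) (ys [ j ]≔ b)))))
    ≡⟨ 𝔼ᵏ-cong k m (λ xs → sym (𝔼ᵏ-comm-𝔼 ℓ n m _)) ⟩
  𝔼ᵏ k m (λ xs → 𝔼ᵏ ℓ n (λ ys → 𝔼 m (λ a → 𝔼 n (λ b → F (xs [ i ]≔ a) (ys [ j ]≔ b))))) ∎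
  where open ≡-Reasoning

In01-0 : In01 0ℚ
In01-0 = ≤-refl , nonNegative⁻¹ 1ℚ

In01-1 : In01 1ℚ
In01-1 = nonNegative⁻¹ 1ℚ , ≤-refl

In01-* : ∀ {p q} → In01 p → In01 q → In01 (p * q)
In01-* {p} {q} (0≤p , p≤1) (0≤q , q≤1) =
  nonNegative⁻¹ (p * q) {{nonNeg*nonNeg⇒nonNeg p {{nonNegative 0≤p}} q {{nonNegative 0≤q}}}} ,
  ≤-trans (*-monoʳ-≤-nonNeg q {{nonNegative 0≤q}} p≤1) (≤-trans (≤-reflexive (*-identityˡ q)) q≤1)

In01-prodFin : ∀ n {f : Fin n → ℚ} → (∀ i → In01 (f i)) → In01 (prodFin n f)
In01-prodFin zero    f∈ = In01-1
In01-prodFin (suc n) f∈ = In01-* (f∈ zero) (In01-prodFin n (λ i → f∈ (suc i)))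

module _ {m n : ℕ} .{{_ : NonZero m}} .{{_ : NonZero n}}
         (T : Fin m → Fin n → Bool) (τ γ : ℚ) (spread : CombSpread m n T τ γ) where

  CombSpread⇒0≤γ : 0ℚ ≤ γ
  CombSpread⇒0≤γ = begin
    0ℚ                                             ≡⟨ sym (trans (𝔼-cong m (λ x → 𝔼-cong n (λ y → *-zeroˡ (𝟙 (T x y)))))
                                                                 (trans (𝔼-const m _) (𝔼-const n 0ℚ))) ⟩
    𝔼 m (λ x → 𝔼 n (λ y → 0ℚ * 0ℚ * 𝟙 (T x y)))    ≤⟨ spread _ _ (λ _ → In01-0) (λ _ → In01-0) ⟩
    τ * 𝔼 m (λ _ → 0ℚ) * 𝔼 n (λ _ → 0ℚ) + γ        ≡⟨ cong₂ (λ s t → τ * s * t + γ) (𝔼-const m 0ℚ) (𝔼-const n 0ℚ) ⟩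
    τ * 0ℚ * 0ℚ + γ                                ≡⟨ cong (_+ γ) (*-zeroʳ (τ * 0ℚ)) ⟩
    0ℚ + γ                                         ≡⟨ +-identityˡ γ ⟩
    γ                                              ∎
    where open ≤-Reasoning

  CombSpread-weighted : (f : Fin m → ℚ) (g : Fin n → ℚ) (c : ℚ) →
    (∀ x → In01 (f x)) → (∀ y → In01 (g y)) → In01 c →
    𝔼 m (λ x → 𝔼 n (λ y → 𝟙 (T x y) * (f x * (g y * c))))
      ≤ τ * 𝔼 m (λ x → 𝔼 n (λ y → f x * (g y * c))) + γ
  CombSpread-weighted f g c f∈ g∈ (0≤c , c≤1) = begin
    𝔼 m (λ x → 𝔼 n (λ y → 𝟙 (T x y) * (f x * (g y * c))))
      ≡⟨ 𝔼-cong m (λ x → 𝔼-cong n (λ y → solve 4 (λ t p q r → t :* (p :* (q :* r)) := r :* (p :* q :* t))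
                                                     refl (𝟙 (T x y)) (f x) (g y) c)) ⟩
    𝔼 m (λ x → 𝔼 n (λ y → c * (f x * g y * 𝟙 (T x y))))
      ≡⟨ trans (𝔼-cong m (λ x → 𝔼-*ˡ n c _)) (𝔼-*ˡ m c _) ⟩
    c * 𝔼 m (λ x → 𝔼 n (λ y → f x * g y * 𝟙 (T x y)))
      ≤⟨ *-monoˡ-≤-nonNeg c {{nonNegative 0≤c}} (spread f g f∈ g∈) ⟩
    c * (τ * 𝔼 m f * 𝔼 n g + γ)
      ≡⟨ solve 5 (λ c t p q r → c :* (t :* p :* q :+ r) := t :* (p :* (q :* c)) :+ c :* r) refl c τ (𝔼 m f) (𝔼 n g) γ ⟩
    τ * (𝔼 m f * (𝔼 n g * c)) + c * γ
      ≤⟨ +-monoʳ-≤ (τ * (𝔼 m f * (𝔼 n g * c))) cγ≤γ ⟩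
    τ * (𝔼 m f * (𝔼 n g * c)) + γ
      ≡⟨ cong (λ s → τ * s + γ) (sym 𝔼-product) ⟩
    τ * 𝔼 m (λ x → 𝔼 n (λ y → f x * (g y * c))) + γ
      ∎
    where
    open ≤-Reasoning
    cγ≤γ : c * γ ≤ γ
    cγ≤γ = ≤-trans (*-monoʳ-≤-nonNeg γ {{nonNegative CombSpread⇒0≤γ}} c≤1) (≤-reflexive (*-identityˡ γ))
    𝔼-product : 𝔼 m (λ x → 𝔼 n (λ y → f x * (g y * c))) ≡ 𝔼 m f * (𝔼 n g * c)
    𝔼-product = trans (𝔼-cong m (λ x → trans (𝔼-*ˡ n (f x) _) (cong (f x *_) (𝔼-*ʳ n c g))))
                      (𝔼-*ʳ m _ f)

gridProduct : ∀ {k ℓ m n} → (Fin k → Fin ℓ → Fin m → Fin n → ℚ) → (Fin k → Fin m) → (Fin ℓ → Fin n) → ℚ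
gridProduct {k} {ℓ} W xs ys = prodFin k (λ i → prodFin ℓ (λ j → W i j (xs i) (ys j)))

In01-gridProduct : ∀ {k ℓ m n} {W : Fin k → Fin ℓ → Fin m → Fin n → ℚ} →
                   (∀ i j x y → In01 (W i j x y)) → ∀ xs ys → In01 (gridProduct W xs ys)
In01-gridProduct {k} {ℓ} W∈ xs ys = In01-prodFin k (λ i → In01-prodFin ℓ (λ j → W∈ i j (xs i) (ys j)))

mask : Bool → ℚ → ℚ
mask b q = if b then q else 1ℚ

In01-mask : ∀ b {q} → In01 q → In01 (mask b q)
In01-mask true  q∈ = q∈
In01-mask false q∈ = In01-1

module GridResampling {k ℓ m n : ℕ} (W : Fin k → Fin ℓ → Fin m → Fin n → ℚ)
                      (i* : Fin k) (j* : Fin ℓ) (W-removed : ∀ x y → W i* j* x y ≡ 1ℚ)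
                      (xs : Fin k → Fin m) (ys : Fin ℓ → Fin n) where

  rowPart : Fin m → ℚ
  rowPart a = gridProduct (λ i j x y → mask ⌊ i ≟ i* ⌋ (W i j x y)) (λ _ → a) ys

  columnPart : Fin n → ℚ
  columnPart b = gridProduct (λ i j x y → mask (not ⌊ i ≟ i* ⌋ ∧ ⌊ j ≟ j* ⌋) (W i j x y)) xs (λ _ → b)

  restPart : ℚ
  restPart = gridProduct (λ i j x y → mask (not (⌊ i ≟ i* ⌋ ∨ ⌊ j ≟ j* ⌋)) (W i j x y)) xs ys

  resampled-entry : ∀ a b i j →
    W i j ((xs [ i* ]≔ a) i) ((ys [ j* ]≔ b) j)
      ≡ mask ⌊ i ≟ i* ⌋ (W i j a (ys j))
        * (mask (not ⌊ i ≟ i* ⌋ ∧ ⌊ j ≟ j* ⌋) (W i j (xs i) b)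
           * mask (not (⌊ i ≟ i* ⌋ ∨ ⌊ j ≟ j* ⌋)) (W i j (xs i) (ys j)))
  resampled-entry a b i j with i ≟ i* | j ≟ j*
  ... | yes refl | yes refl = trans (W-removed _ _) (sym (trans (*-identityʳ _) (W-removed _ _)))
  ... | yes refl | no j≢j*  = trans (cong₂ (W i j) ([]≔-updates xs i* a) ([]≔-minimal ys j* b j≢j*))
                                    (sym (*-identityʳ _))
  ... | no i≢i*  | yes refl = trans (cong₂ (W i j) ([]≔-minimal xs i* a i≢i*) ([]≔-updates ys j* b))
                                    (sym (trans (*-identityˡ _) (*-identityʳ _)))
  ... | no i≢i*  | no j≢j*  = trans (cong₂ (W i j) ([]≔-minimal xs i* a i≢i*) ([]≔-minimal ys j* b j≢j*))
                                    (sym (trans (*-identityˡ _) (*-identityˡ _)))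

  resampled-factorisation : ∀ a b →
    gridProduct W (xs [ i* ]≔ a) (ys [ j* ]≔ b) ≡ rowPart a * (columnPart b * restPart)
  resampled-factorisation a b = begin
    gridProduct W (xs [ i* ]≔ a) (ys [ j* ]≔ b)
      ≡⟨ prodFin-cong k (λ i → prodFin-cong ℓ (resampled-entry a b i)) ⟩
    prodFin k (λ i → prodFin ℓ (λ j → α i j * (β i j * γ i j)))
      ≡⟨ prodFin²-* α (λ i j → β i j * γ i j) ⟩
    rowPart a * prodFin k (λ i → prodFin ℓ (λ j → β i j * γ i j))
      ≡⟨ cong (rowPart a *_) (prodFin²-* β γ) ⟩
    rowPart a * (columnPart b * restPart) ∎
    where
    open ≡-Reasoning
    α β γ : Fin k → Fin ℓ → ℚ
    α i j = mask ⌊ i ≟ i* ⌋ (W i j a (ys j))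
    β i j = mask (not ⌊ i ≟ i* ⌋ ∧ ⌊ j ≟ j* ⌋) (W i j (xs i) b)
    γ i j = mask (not (⌊ i ≟ i* ⌋ ∨ ⌊ j ≟ j* ⌋)) (W i j (xs i) (ys j))
    prodFin²-* : (f g : Fin k → Fin ℓ → ℚ) →
      prodFin k (λ i → prodFin ℓ (λ j → f i j * g i j))
        ≡ prodFin k (λ i → prodFin ℓ (f i)) * prodFin k (λ i → prodFin ℓ (g i))
    prodFin²-* f g = trans (prodFin-cong k (λ i → prodFin-* ℓ (f i) (g i))) (prodFin-* k _ _)

module _ {m n : ℕ} .{{_ : NonZero m}} .{{_ : NonZero n}}
         (T : Fin m → Fin n → Bool) (τ γ : ℚ) (spread : CombSpread m n T τ γ)
         {k ℓ : ℕ} (W : Fin k → Fin ℓ → Fin m → Fin n → ℚ) (W∈ : ∀ i j x y → In01 (W i j x y))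
         (i* : Fin k) (j* : Fin ℓ) (W-removed : ∀ x y → W i* j* x y ≡ 1ℚ) where

  CombSpread-resampled : ∀ xs ys →
    𝔼 m (λ a → 𝔼 n (λ b → 𝟙 (T ((xs [ i* ]≔ a) i*) ((ys [ j* ]≔ b) j*))
                          * gridProduct W (xs [ i* ]≔ a) (ys [ j* ]≔ b)))
      ≤ τ * 𝔼 m (λ a → 𝔼 n (λ b → gridProduct W (xs [ i* ]≔ a) (ys [ j* ]≔ b))) + γ
  CombSpread-resampled xs ys = begin
    𝔼 m (λ a → 𝔼 n (λ b → 𝟙 (T ((xs [ i* ]≔ a) i*) ((ys [ j* ]≔ b) j*))
                          * gridProduct W (xs [ i* ]≔ a) (ys [ j* ]≔ b)))
      ≡⟨ 𝔼-cong m (λ a → 𝔼-cong n (λ b →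
           cong₂ (λ x y → 𝟙 (T x y) * gridProduct W (xs [ i* ]≔ a) (ys [ j* ]≔ b))
                 ([]≔-updates xs i* a) ([]≔-updates ys j* b))) ⟩
    𝔼 m (λ a → 𝔼 n (λ b → 𝟙 (T a b) * gridProduct W (xs [ i* ]≔ a) (ys [ j* ]≔ b)))
      ≡⟨ 𝔼-cong m (λ a → 𝔼-cong n (λ b → cong (𝟙 (T a b) *_) (resampled-factorisation a b))) ⟩
    𝔼 m (λ a → 𝔼 n (λ b → 𝟙 (T a b) * (rowPart a * (columnPart b * restPart))))
      ≤⟨ CombSpread-weighted T τ γ spread rowPart columnPart restPart
           (λ a → In01-gridProduct (λ i j x y → In01-mask _ (W∈ i j x y)) (λ _ → a) ys)
           (λ b → In01-gridProduct (λ i j x y → In01-mask _ (W∈ i j x y)) xs (λ _ → b))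
           (In01-gridProduct (λ i j x y → In01-mask _ (W∈ i j x y)) xs ys) ⟩
    τ * 𝔼 m (λ a → 𝔼 n (λ b → rowPart a * (columnPart b * restPart))) + γ
      ≡⟨ cong (λ s → τ * s + γ) (sym (𝔼-cong m (λ a → 𝔼-cong n (resampled-factorisation a)))) ⟩
    τ * 𝔼 m (λ a → 𝔼 n (λ b → gridProduct W (xs [ i* ]≔ a) (ys [ j* ]≔ b))) + γ
      ∎
    where
    open ≤-Reasoning
    open GridResampling W i* j* W-removed xs ys

  CombSpread-gridProduct :
    𝔼ᵏ k m (λ xs → 𝔼ᵏ ℓ n (λ ys → 𝟙 (T (xs i*) (ys j*)) * gridProduct W xs ys))
      ≤ τ * 𝔼ᵏ k m (λ xs → 𝔼ᵏ ℓ n (gridProduct W xs)) + γ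
  CombSpread-gridProduct = begin
    𝔼ᵏ k m (λ xs → 𝔼ᵏ ℓ n (λ ys → 𝟙 (T (xs i*) (ys j*)) * gridProduct W xs ys))
      ≡⟨ 𝔼ᵏ²-resample k ℓ m n i* j* _ ⟩
    𝔼ᵏ k m (λ xs → 𝔼ᵏ ℓ n (λ ys → 𝔼 m (λ a → 𝔼 n (λ b →
      𝟙 (T ((xs [ i* ]≔ a) i*) ((ys [ j* ]≔ b) j*)) * gridProduct W (xs [ i* ]≔ a) (ys [ j* ]≔ b)))))
      ≤⟨ 𝔼ᵏ-mono-≤ k m (λ xs → 𝔼ᵏ-mono-≤ ℓ n (CombSpread-resampled xs)) ⟩
    𝔼ᵏ k m (λ xs → 𝔼ᵏ ℓ n (λ ys → τ * resampled xs ys + γ))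
      ≡⟨ trans (𝔼ᵏ-cong k m (λ xs → 𝔼ᵏ-affine ℓ n τ γ (resampled xs))) (𝔼ᵏ-affine k m τ γ _) ⟩
    τ * 𝔼ᵏ k m (λ xs → 𝔼ᵏ ℓ n (resampled xs)) + γ
      ≡⟨ cong (λ s → τ * s + γ) (sym (𝔼ᵏ²-resample k ℓ m n i* j* (gridProduct W))) ⟩
    τ * 𝔼ᵏ k m (λ xs → 𝔼ᵏ ℓ n (gridProduct W xs)) + γ
      ∎
    where
    open ≤-Reasoning
    resampled : (Fin k → Fin m) → (Fin ℓ → Fin n) → ℚ
    resampled xs ys = 𝔼 m (λ a → 𝔼 n (λ b → gridProduct W (xs [ i* ]≔ a) (ys [ j* ]≔ b)))

edgeWeight : ∀ {k ℓ m n} → (Fin k → Fin ℓ → Bool) → Fin k → Fin ℓ →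
             (Fin k → Fin ℓ → Fin m → Fin n → ℚ) → Fin k → Fin ℓ → Fin m → Fin n → ℚ
edgeWeight E i* j* f i j x y = mask (InEMinus E i* j* i j) (f i j x y)

edgeWeight-removed : ∀ {k ℓ m n} (E : Fin k → Fin ℓ → Bool) i* j* (f : Fin k → Fin ℓ → Fin m → Fin n → ℚ) x y →
                     edgeWeight E i* j* f i* j* x y ≡ 1ℚ
edgeWeight-removed E i* j* f x y with i* ≟ i* | j* ≟ j*
... | yes _     | yes _     rewrite ∧-zeroʳ (E i* j*) = refl
... | no i*≢i*  | _         = contradiction refl i*≢i*
... | yes _     | no j*≢j*  = contradiction refl j*≢j*

lemma3p2 : (m n : ℕ) → .{{_ : NonZero m}} → .{{_ : NonZero n}} →
    (T : Fin m → Fin n → Bool) (τ γ : ℚ) → CombSpread m n T τ γ →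
    (k ℓ : ℕ) → .{{_ : NonZero k}} → .{{_ : NonZero ℓ}} →
    (E : Fin k → Fin ℓ → Bool) (i* : Fin k) (j* : Fin ℓ) → E i* j* ≡ true →
    (f : Fin k → Fin ℓ → Fin m → Fin n → ℚ) →
    (∀ i j → InEMinus E i* j* i j ≡ true → ∀ x y → In01 (f i j x y)) →
    𝔼ᵏ k m (λ xs → 𝔼ᵏ ℓ n (λ ys →
        𝟙 (T (xs i*) (ys j*)) * prodEdges E i* j* f xs ys))
      ≤ τ * 𝔼ᵏ k m (λ xs → 𝔼ᵏ ℓ n (λ ys → prodEdges E i* j* f xs ys)) + γ
lemma3p2 m n T τ γ spread k ℓ E i* j* _ f f∈ =
  CombSpread-gridProduct T τ γ spread (edgeWeight E i* j* f) edgeWeight∈ i* j* (edgeWeight-removed E i* j* f)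
  where
  edgeWeight∈ : ∀ i j x y → In01 (edgeWeight E i* j* f i j x y)
  edgeWeight∈ i j x y with InEMinus E i* j* i j in edge
  ... | true  = f∈ i j edge x y
  ... | false = In01-1
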